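{- Suppose $S$ is normal, $\omega_S=(x^{\mathbf 1}t^{\frac{n+1}{2}})$, and $G_1,\dots,G_s$ is a $\lceil\frac n2\rceil$-$\tau$-reduction of $G$ in which $G_s$ is a cycle of length $3$, $5$ or $7$. Then $G_1,\dots,G_s$ is strong.
   Context: $G$ is a connected simple graph with $V(G)=\{x_1,\dots,x_n\}$, $E(G)=\{y_1,\dots,y_q\}\neq\emptyset$; $v_k=e_i+e_j\in\mathbb{R}^n$ is the characteristic vector of $y_k=\{x_i,x_j\}$; $S=K[x_1t,\dots,x_nt,x^{v_1}t,\dots,x^{v_q}t,t]\subset K[x_1,\dots,x_n][t]$ for a field $K$; $x^{\mathbf 1}=x_1\cdots x_n$. When $S$ is normal its canonical module is the ideal $\omega_S$ of $S$ generated by the monomials $x^at^b$ with $(a,b)\in\mathbb{N}B\cap(\mathbb{R}_+B)^\circ$, where $B=\{(e_1,1),\dots,(e_n,1),(v_1,1),\dots,(v_q,1),(0,\dots,0,1)\}$ and $\mathbb{N}B$, $\mathbb{R}_+B$, $(\mathbb{R}_+B)^\circ$ are its nonnegative integer combinations, its cone, and the interior of the cone in $\mathbb{R}^{n+1}$. $\tau(G)$ is the minimum size of a vertex cover. A $\tau$-reduction is a family of induced subgraphs $G_1,\dots,G_s$ whose vertex sets partition $V(G)$ with $\tau(G)=\sum\tau(G_i)$; it is a $\lceil\frac n2\rceil$-$\tau$-reduction if $G_1,\dots,G_{s-1}$ are edges of $G$ and $G_s$ is an edge or a $3$-, $5$- or $7$-cycle. It is strong if $G_s$ is an edge, or $G_s$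 is such a cycle and for every $x\in N_G[V(G_s)]$ and every odd cycle $C$ of $G$ there is an edge $y$ with $x\in y$ and $y\cap V(C)\neq\emptyset$; here $N_G[A]$ is $A$ together with all vertices lying on an edge that meets $A$. -}

module Defs where

open import Data.Nat as ℕ using (ℕ; zero; suc; _≤_)
open import Data.Integer as ℤ using (ℤ; +_)
open import Data.Rational as ℚ using (ℚ; 0ℚ; 1ℚ; _/_)
open import Data.Fin using (Fin; zero; suc; toℕ; inject₁; fromℕ)
open import Data.Fin.Subset using (Subset; _∈_; _⊆_; ∣_∣; ⊤)
open import Data.Bool using (Bool; true; false; T)
open import Data.Product using (Σ; ∃; ∃-syntax; _×_; _,_)
open import Data.Sum using (_⊎_)
open import Function.Definitions using (Injective)
open import Function.Bundles using (_⇔_)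
open import Relation.Binary.PropositionalEquality using (_≡_)
open import Relation.Nullary using (¬_)

record Graph (n : ℕ) : Set where
  field
    adj   : Fin n → Fin n → Bool
    sym   : ∀ i j → adj i j ≡ adj j i
    irrefl : ∀ i → adj i i ≡ false

open Graph public

Adj : ∀ {n} → Graph n → Fin n → Fin n → Set
Adj G i j = T (adj G i j)

data Reach {n} (G : Graph n) : Fin n → Fin n → Set where
  here : ∀ {u} → Reach G u u
  step : ∀ {u v w} → Adj G u v → Reach G v w → Reach G u w

Connected : ∀ {n} → Graph n → Set
Connected G = ∀ u v → Reach G u v

HasEdge : ∀ {n} → Graph n → Set
HasEdge G = ∃[ i ] ∃[ j ] Adj G i j

∑ : ∀ n → (Fin n → ℚ) → ℚ
∑ zero    f = 0ℚ
∑ (suc n) f = f zero ℚ.+ ∑ n (λ i → f (suc i))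

∑ℕ : ∀ n → (Fin n → ℕ) → ℕ
∑ℕ zero    f = 0
∑ℕ (suc n) f = f zero ℕ.+ ∑ℕ n (λ i → f (suc i))

-- Points of Q^{n+1} = Q^n × Q  (last coordinate is the exponent of t)

Pt : ℕ → Set
Pt n = (Fin n → ℚ) × ℚ

_≐_ : ∀ {n} → Pt n → Pt n → Set
(a , b) ≐ (a' , b') = (∀ i → a i ≡ a' i) × b ≡ b'

-- The combination  Σ_i λ_i (e_i,1) + Σ_{(i,j)} μ_ij (e_i+e_j,1) + ν (0,1).
-- μ ranges over ordered pairs, supported on edges (both orientations give
-- the same generator (v_k,1), so this describes the same set of combinations).
combo : ∀ {n} → (Fin n → ℚ) → (Fin n → Fin n → ℚ) → ℚ → Pt n
combo {n} l μ ν =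
  (λ i → l i ℚ.+ ∑ n (λ j → μ i j ℚ.+ μ j i)) ,
  (∑ n l ℚ.+ ∑ n (λ i → ∑ n (λ j → μ i j)) ℚ.+ ν)

InSpan : ∀ {n} → Graph n → (ℚ → Set) → Pt n → Set
InSpan {n} G P p =
  Σ (Fin n → ℚ) λ l → Σ (Fin n → Fin n → ℚ) λ μ → Σ ℚ λ ν →
    (∀ i → P (l i)) × (∀ i j → P (μ i j)) × P ν ×
    (∀ i j → ¬ Adj G i j → μ i j ≡ 0ℚ) ×
    (combo l μ ν ≐ p)

IsNat IsInt NonNeg : ℚ → Set
IsNat q = ∃[ k ] q ≡ (+ k) / 1
IsInt q = ∃[ z ] q ≡ z / 1
NonNeg q = 0ℚ ℚ.≤ q

-- ℕB, ℤB and the cone ℝ₊B (restricted to rational points)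
InNB InZB InCone : ∀ {n} → Graph n → Pt n → Set
InNB G = InSpan G IsNat
InZB G = InSpan G IsInt
InCone G = InSpan G NonNeg

IntPt : ∀ {n} → Pt n → Set
IntPt (a , b) = (∀ i → IsInt (a i)) × IsInt b

-- interior of the cone (rational points; sup-norm balls)
InInterior : ∀ {n} → Graph n → Pt n → Set
InInterior G (a , b) =
  Σ ℚ λ ε → (0ℚ ℚ.< ε) ×
    (∀ (q : Pt _) → (∀ i → ℚ.∣ Data.Product.proj₁ q i ℚ.- a i ∣ ℚ.< ε) →
       ℚ.∣ Data.Product.proj₂ q ℚ.- b ∣ ℚ.< ε → InCone G q)

-- S = K[ℕB] is normal  ⟺  ℕB = ℤB ∩ ℝ₊B  (the inclusion ⊆ is automatic)
Normal : ∀ {n} → Graph n → Set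
Normal G = ∀ p → IntPt p → InZB G p → InCone G p → InNB G p

-- ω_S = (x^𝟏 t^{(n+1)/2}) : equality of monomial ideals, i.e. the monomials
-- of ω_S (exponents in ℕB ∩ (ℝ₊B)°) are exactly those of x^𝟏 t^c · S,
-- where 2c = n+1.
OmegaPrincipal : ∀ {n} → Graph n → Set
OmegaPrincipal {n} G =
  Σ ℕ λ c → (2 ℕ.* c ≡ suc n) ×
    (∀ (p : Pt n) →
       (InNB G p × InInterior G p) ⇔
       InNB G ((λ i → Data.Product.proj₁ p i ℚ.- 1ℚ) ,
               (Data.Product.proj₂ p ℚ.- (+ c) / 1)))

IsCoverOf : ∀ {n} → Graph n → Subset n → Subset n → Set
IsCoverOf G A C = C ⊆ A × (∀ i j → i ∈ A → j ∈ A → Adj G i j → i ∈ C ⊎ j ∈ C)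

HasTau : ∀ {n} → Graph n → Subset n → ℕ → Set
HasTau G A k = (∃[ C ] IsCoverOf G A C × ∣ C ∣ ≡ k) ×
               (∀ C → IsCoverOf G A C → k ≤ ∣ C ∣)

CycNext : ∀ {m} → Fin (suc m) → Fin (suc m) → Set
CycNext {m} i j = toℕ j ≡ suc (toℕ i) ⊎ (toℕ i ≡ m × toℕ j ≡ 0)

CycAdj : ∀ {m} → Fin (suc m) → Fin (suc m) → Set
CycAdj i j = CycNext i j ⊎ CycNext j i

IsInducedCycle : ∀ {n} → Graph n → Subset n → ℕ → Set
IsInducedCycle {n} G A m =
  Σ (Fin (suc m) → Fin n) λ f → Injective _≡_ _≡_ f ×
    (∀ v → v ∈ A ⇔ (∃[ i ] f i ≡ v)) ×
    (∀ i j → Adj G (f i) (f j) ⇔ CycAdj i j)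

IsSmallOddCycle : ∀ {n} → Graph n → Subset n → Set
IsSmallOddCycle G A =
  Σ ℕ λ m → (suc m ≡ 3 ⊎ suc m ≡ 5 ⊎ suc m ≡ 7) × IsInducedCycle G A m

-- f is an odd cycle of G (a subgraph, length 2k+1 ≥ 3)
IsOddCycle : ∀ {n} → Graph n → (k : ℕ) → (Fin (suc (k ℕ.+ k)) → Fin n) → Set
IsOddCycle G k f = 1 ≤ k × Injective _≡_ _≡_ f ×
  (∀ i j → CycNext i j → Adj G (f i) (f j))

IsEdgePart : ∀ {n} → Graph n → Subset n → Set
IsEdgePart G A = ∃[ a ] ∃[ b ] Adj G a b × (∀ v → v ∈ A ⇔ (v ≡ a ⊎ v ≡ b))

-- τ-reductions; the family is G_1,...,G_{s+1} indexed by Fin (suc s),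
-- the distinguished last member G_s of the paper being  P (fromℕ s).

IsPartition : ∀ {n r} → (Fin r → Subset n) → Set
IsPartition P = (∀ i → ∃[ v ] v ∈ P i) ×
  (∀ v → ∃[ i ] v ∈ P i) × (∀ v i j → v ∈ P i → v ∈ P j → i ≡ j)

IsTauReduction : ∀ {n r} → Graph n → (Fin r → Subset n) → Set
IsTauReduction {n} {r} G P = IsPartition P ×
  Σ (Fin r → ℕ) λ t → (∀ i → HasTau G (P i) (t i)) × HasTau G ⊤ (∑ℕ r t)

IsCeilTauReduction : ∀ {n} → Graph n → (s : ℕ) → (Fin (suc s) → Subset n) → Set
IsCeilTauReduction G s P = IsTauReduction G P ×
  (∀ (i : Fin s) → IsEdgePart G (P (inject₁ i))) ×
  (IsEdgePart G (P (fromℕ s)) ⊎ IsSmallOddCycle G (P (fromℕ s)))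

InClosedNbhd : ∀ {n} → Graph n → Subset n → Fin n → Set
InClosedNbhd G A x = x ∈ A ⊎ (∃[ a ] a ∈ A × Adj G x a)

IsStrong : ∀ {n} → Graph n → (s : ℕ) → (Fin (suc s) → Subset n) → Set
IsStrong {n} G s P = IsEdgePart G (P (fromℕ s)) ⊎
  (IsSmallOddCycle G (P (fromℕ s)) ×
   (∀ x → InClosedNbhd G (P (fromℕ s)) x →
    ∀ k (f : Fin (suc (k ℕ.+ k)) → Fin n) → IsOddCycle G k f →
    ∃[ z ] Adj G x z × ((∃[ i ] f i ≡ x) ⊎ (∃[ i ] f i ≡ z))))

{-# OPTIONS --safe #-}
module Submission where

-- Let C = G_s, let x ∈ N_G[C], and let f be an odd cycle of length 2k + 1 such that x is
-- neither on f nor adjacent to it. The edges G_1, …, G_{s-1}, an edge from x to a neighbour y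
-- on C and a perfect matching of the path C − y write (𝟏 + e_x , c) as a sum of edge
-- generators; there are c of them because their degrees add up to n + 1 = 2c. Adding the
-- edges of f and the generator (e_x , 1) gives (𝟏 + 2a , c + 2(k + 1)) ∈ ℕB, where
-- a = χ_f + e_x. As ω_S = x^𝟏 t^c S, the point 2(𝟏 + a , c + k + 1) lies in ℕB and in the
-- interior of the cone; hence so does its half, by normality, and dividing by x^𝟏 t^c again
-- gives (a , k + 1) ∈ ℕB. This is impossible: since no edge joins x to f, the weight
-- w = χ_f + 2e_x is at most 2 on every generator, so w · p ≤ 2b for all (p , b) ∈ ℕB, whereas
-- w · a = 2k + 3.

open import Defs hiding (sym)
open import Data.Nat using (ℕ; suc)
open import Data.Fin using (Fin; fromℕ)
open import Data.Fin.Subset using (Subset)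

open import Data.Nat using (zero; _+_; _*_; _≤_; z≤n; s≤s)
import Data.Nat.Properties as ℕP
open import Data.Nat.Solver using (module +-*-Solver)
open import Data.Nat.GeneralisedArithmetic using (fold)
open import Data.Nat.Coprimality as Coprime using (1-coprimeTo)
open import Data.Integer as ℤ using (-[1+_])
import Data.Integer.Properties as ℤP
open import Data.Rational as ℚ using (ℚ; 0ℚ; 1ℚ; _/_; ½; mkℚ)
import Data.Rational.Properties as ℚP
import Data.Rational.Solver as ℚS
open import Data.Rational.Unnormalised using (*≡*)
import Data.Rational.Unnormalised.Properties as ℚᵘP
open import Data.Fin as Fin using (zero; suc; toℕ; inject₁; _≟_)
import Data.Fin.Properties as FinP
open import Data.Fin.Subset using (_∈_)
open import Data.Fin.Subset.Properties using (_∈?_)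
open import Data.Product using (Σ; ∃-syntax; _×_; _,_; proj₁; proj₂)
open import Data.Sum using (_⊎_; inj₁; inj₂)
open import Data.Bool using (T)
open import Data.Empty using (⊥; ⊥-elim)
open import Function.Base using (_∘_)
open import Function.Bundles using (_⇔_; Equivalence)
open import Function.Definitions using (Injective)
open import Relation.Binary.PropositionalEquality
  using (_≡_; _≢_; refl; sym; trans; cong; cong₂; subst; module ≡-Reasoning)
open import Relation.Nullary using (¬_; Dec; yes; no; contradiction)
open import Relation.Nullary.Decidable using (T?)

open import Algebra.Properties.CommutativeSemigroup ℕP.+-commutativeSemigroup
  using () renaming (interchange to +-interchange)
open import Algebra.Properties.Semiring.Sum ℕP.+-*-semiring
  using ( sum; sum-cong-≗; ∑-distrib-+; ∑-comm; *-distribˡ-sum; *-distribʳ-sum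
        ; sum-init-last; sum-remove; sum-replicate-zero)

𝟙 : ∀ {p} {P : Set p} → Dec P → ℕ
𝟙 (yes _) = 1
𝟙 (no _)  = 0

𝟙-yes : ∀ {p} {P : Set p} (P? : Dec P) → P → 𝟙 P? ≡ 1
𝟙-yes (yes _) _ = refl
𝟙-yes (no ¬p) p = contradiction p ¬p

𝟙-no : ∀ {p} {P : Set p} (P? : Dec P) → ¬ P → 𝟙 P? ≡ 0
𝟙-no (yes p) ¬p = contradiction p ¬p
𝟙-no (no _)  _  = refl

δ : ∀ {n} → Fin n → Fin n → ℕ
δ i j = 𝟙 (i ≟ j)

χ : ∀ {n} → Subset n → Fin n → ℕ
χ A v = 𝟙 (v ∈? A)

sum-ones : ∀ n → sum {n} (λ _ → 1) ≡ n
sum-ones zero    = refl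
sum-ones (suc n) = cong suc (sum-ones n)

sum-mono-≤ : ∀ {n} {f g : Fin n → ℕ} → (∀ i → f i ≤ g i) → sum f ≤ sum g
sum-mono-≤ {zero}  _   = z≤n
sum-mono-≤ {suc n} f≤g = ℕP.+-mono-≤ (f≤g zero) (sum-mono-≤ (f≤g ∘ suc))

sum-single : ∀ {n} (f : Fin n → ℕ) i → (∀ j → j ≢ i → f j ≡ 0) → sum f ≡ f i
sum-single {suc n} f i others-zero = begin
  sum f                          ≡⟨ sum-remove {i = i} f ⟩
  f i + sum (f ∘ Fin.punchIn i)  ≡⟨ cong (f i +_) (trans (sum-cong-≗ punched-zero) (sum-replicate-zero n)) ⟩
  f i + 0                        ≡⟨ ℕP.+-identityʳ (f i) ⟩
  f i                            ∎
  where
  open ≡-Reasoning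
  punched-zero : ∀ j → f (Fin.punchIn i j) ≡ 0
  punched-zero j = others-zero _ (FinP.punchInᵢ≢i i j)

sum-δ : ∀ {n} (j : Fin n) → sum (λ i → δ i j) ≡ 1
sum-δ j = trans (sum-single _ j (λ i i≢j → 𝟙-no (i ≟ j) i≢j)) (𝟙-yes (j ≟ j) refl)

partition-χ : ∀ {n r} {P : Fin r → Subset n} → IsPartition P → ∀ v → sum (λ i → χ (P i) v) ≡ 1
partition-χ {P = P} (_ , covered , disjoint) v = trans (sum-single _ i others-zero) (𝟙-yes (v ∈? P i) v∈Pi)
  where
  i = proj₁ (covered v)
  v∈Pi = proj₂ (covered v)
  others-zero : ∀ j → j ≢ i → χ (P j) v ≡ 0
  others-zero j j≢i = 𝟙-no (v ∈? P j) (λ v∈Pj → j≢i (disjoint v j i v∈Pj v∈Pi))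

occ : ∀ {M n} → (Fin M → Fin n) → Fin n → ℕ
occ h v = sum (λ t → δ v (h t))

occ-image : ∀ {M n} {h : Fin M → Fin n} → Injective _≡_ _≡_ h → ∀ {v} t → h t ≡ v → occ h v ≡ 1
occ-image {h = h} h-inj {v} t ht≡v = begin
  occ h v    ≡⟨ sum-single _ t (λ t′ t′≢t → 𝟙-no (v ≟ h t′) (t′≢t ∘ h-inj ∘ other-preimage t′)) ⟩
  δ v (h t)  ≡⟨ 𝟙-yes (v ≟ h t) (sym ht≡v) ⟩
  1          ∎
  where
  open ≡-Reasoning
  other-preimage : ∀ t′ → v ≡ h t′ → h t′ ≡ h t
  other-preimage t′ v≡ht′ = trans (sym v≡ht′) (sym ht≡v)

occ-∉ : ∀ {M n} {h : Fin M → Fin n} {v} → (∀ t → h t ≢ v) → occ h v ≡ 0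
occ-∉ {M} {h = h} {v} v∉h = trans (sum-cong-≗ (λ t → 𝟙-no (v ≟ h t) (v∉h t ∘ sym))) (sum-replicate-zero M)

occ-≤1 : ∀ {M n} {h : Fin M → Fin n} → Injective _≡_ _≡_ h → ∀ v → occ h v ≤ 1
occ-≤1 {h = h} h-inj v with FinP.any? (λ t → h t ≟ v)
... | yes (t , ht≡v) = ℕP.≤-reflexive (occ-image h-inj t ht≡v)
... | no  v∉h        = ℕP.≤-trans (ℕP.≤-reflexive (occ-∉ (λ t ht≡v → v∉h (t , ht≡v)))) z≤n

sum-occ : ∀ {M n} (h : Fin M → Fin n) → sum (occ h) ≡ M
sum-occ {M} h = begin
  sum (λ v → sum (λ t → δ v (h t)))  ≡⟨ ∑-comm (λ v t → δ v (h t)) ⟩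
  sum (λ t → sum (λ v → δ v (h t)))  ≡⟨ sum-cong-≗ (λ t → sum-δ (h t)) ⟩
  sum {M} (λ _ → 1)                  ≡⟨ sum-ones M ⟩
  M                                  ∎
  where open ≡-Reasoning

occ-init-last : ∀ {m n} (g : Fin (suc m) → Fin n) v →
  occ g v ≡ occ (g ∘ inject₁) v + δ v (g (fromℕ m))
occ-init-last g v = sum-init-last (λ t → δ v (g t))

enumeration-χ : ∀ {n M} {h : Fin M → Fin n} {A} → Injective _≡_ _≡_ h →
  (∀ v → v ∈ A ⇔ (∃[ t ] h t ≡ v)) → ∀ v → occ h v ≡ χ A v
enumeration-χ {A = A} h-inj enum v with v ∈? A
... | yes v∈A = occ-image h-inj (proj₁ (Equivalence.to (enum v) v∈A)) (proj₂ (Equivalence.to (enum v) v∈A))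
... | no  v∉A = occ-∉ (λ t ht≡v → v∉A (Equivalence.from (enum v) (t , ht≡v)))

-- Cyclic successor and closed walks

next : ∀ {m} → Fin (suc m) → Fin (suc m)
next {zero}  zero    = zero
next {suc m} zero    = suc zero
next {suc m} (suc i) with next i
... | zero  = zero
... | suc j = suc (suc j)

next-fromℕ : ∀ m → next (fromℕ m) ≡ zero
next-fromℕ zero    = refl
next-fromℕ (suc m) rewrite next-fromℕ m = refl

next-inject₁ : ∀ {m} (i : Fin m) → next (inject₁ i) ≡ suc i
next-inject₁ {suc m} zero    = refl
next-inject₁ {suc m} (suc i) rewrite next-inject₁ i = refl

fromℕ-or-inject₁ : ∀ {m} (i : Fin (suc m)) → i ≡ fromℕ m ⊎ ∃[ k ] i ≡ inject₁ k
fromℕ-or-inject₁ {zero}  zero    = inj₁ refl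
fromℕ-or-inject₁ {suc m} zero    = inj₂ (zero , refl)
fromℕ-or-inject₁ {suc m} (suc i) with fromℕ-or-inject₁ i
... | inj₁ i≡last       = inj₁ (cong suc i≡last)
... | inj₂ (k , i≡injk) = inj₂ (suc k , cong suc i≡injk)

cycNext-next : ∀ {m} (i : Fin (suc m)) → CycNext i (next i)
cycNext-next {m} i with fromℕ-or-inject₁ i
... | inj₁ refl        rewrite next-fromℕ m   = inj₂ (FinP.toℕ-fromℕ m , refl)
... | inj₂ (k , refl) rewrite next-inject₁ k = inj₁ (cong suc (sym (FinP.toℕ-inject₁ k)))

sum-rotate : ∀ {m} (f : Fin (suc m) → ℕ) → sum (f ∘ next) ≡ sum f
sum-rotate {m} f = begin
  sum (f ∘ next)                                 ≡⟨ sum-init-last (f ∘ next) ⟩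
  sum (f ∘ next ∘ inject₁) + f (next (fromℕ m))  ≡⟨ cong₂ _+_ (sum-cong-≗ (cong f ∘ next-inject₁))
                                                               (cong f (next-fromℕ m)) ⟩
  sum (f ∘ suc) + f zero                         ≡⟨ ℕP.+-comm (sum (f ∘ suc)) (f zero) ⟩
  sum f                                          ∎
  where open ≡-Reasoning

occ-rotate : ∀ {m n} (g : Fin (suc m) → Fin n) v → occ (g ∘ next) v ≡ occ g v
occ-rotate g v = sum-rotate (λ t → δ v (g t))

IsClosedWalk : ∀ {n m} → Graph n → (Fin (suc m) → Fin n) → Set
IsClosedWalk G g = ∀ i → Adj G (g i) (g (next i))

oddCycle⇒closedWalk : ∀ {n} {G : Graph n} {k f} → IsOddCycle G k f → IsClosedWalk G f
oddCycle⇒closedWalk (_ , _ , f-adj) i = f-adj i (next i) (cycNext-next i)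

inducedCycle⇒closedWalk : ∀ {n} {G : Graph n} {A m} ((g , _) : IsInducedCycle G A m) → IsClosedWalk G g
inducedCycle⇒closedWalk (g , _ , _ , g-adj) i = Equivalence.from (g-adj i (next i)) (inj₁ (cycNext-next i))

Adj-irrefl : ∀ {n} (G : Graph n) {i j} → Adj G i j → i ≢ j
Adj-irrefl G {i} ii refl = subst T (irrefl G i) ii

Adj-sym : ∀ {n} (G : Graph n) {i j} → Adj G i j → Adj G j i
Adj-sym G {i} {j} = subst T (Graph.sym G i j)

-- Combinations of edge generators

record EdgeComb {n} (G : Graph n) (a : Fin n → ℕ) (b : ℕ) : Set where
  field
    mult    : Fin n → Fin n → ℕ
    onEdges : ∀ i j → ¬ Adj G i j → mult i j ≡ 0
    degree  : ∀ v → sum (λ j → mult v j + mult j v) ≡ a v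
    size    : sum (λ i → sum (mult i)) ≡ b

open EdgeComb

module _ {n} {G : Graph n} where

  EdgeComb-cong : ∀ {a a′ b b′} → (∀ v → a v ≡ a′ v) → b ≡ b′ → EdgeComb G a b → EdgeComb G a′ b′
  EdgeComb-cong a≗a′ b≡b′ E = record
    { mult    = mult E
    ; onEdges = onEdges E
    ; degree  = λ v → trans (degree E v) (a≗a′ v)
    ; size    = trans (size E) b≡b′
    }

  EdgeComb-zero : EdgeComb G (λ _ → 0) 0
  EdgeComb-zero = record
    { mult    = λ _ _ → 0
    ; onEdges = λ _ _ _ → refl
    ; degree  = λ _ → sum-replicate-zero n
    ; size    = trans (sum-cong-≗ {n} (λ _ → sum-replicate-zero n)) (sum-replicate-zero n)
    }

  EdgeComb-+ : ∀ {a a′ b b′} → EdgeComb G a b → EdgeComb G a′ b′ →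
    EdgeComb G (λ v → a v + a′ v) (b + b′)
  EdgeComb-+ {a} {a′} {b} {b′} E E′ = record
    { mult    = μ
    ; onEdges = λ i j ¬ij → cong₂ _+_ (onEdges E i j ¬ij) (onEdges E′ i j ¬ij)
    ; degree  = degree-eq
    ; size    = begin
        sum (λ i → sum (μ i))
          ≡⟨ sum-cong-≗ (λ i → ∑-distrib-+ (mult E i) (mult E′ i)) ⟩
        sum (λ i → sum (mult E i) + sum (mult E′ i))
          ≡⟨ ∑-distrib-+ {n} _ _ ⟩
        sum (λ i → sum (mult E i)) + sum (λ i → sum (mult E′ i))
          ≡⟨ cong₂ _+_ (size E) (size E′) ⟩
        b + b′ ∎
    }
    where
    open ≡-Reasoning
    μ : Fin n → Fin n → ℕ
    μ i j = mult E i j + mult E′ i j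
    degree-eq : ∀ v → sum (λ j → μ v j + μ j v) ≡ a v + a′ v
    degree-eq v = begin
      sum (λ j → μ v j + μ j v)
        ≡⟨ sum-cong-≗ (λ j → +-interchange (mult E v j) (mult E′ v j) (mult E j v) (mult E′ j v)) ⟩
      sum (λ j → (mult E v j + mult E j v) + (mult E′ v j + mult E′ j v))
        ≡⟨ ∑-distrib-+ {n} _ _ ⟩
      sum (λ j → mult E v j + mult E j v) + sum (λ j → mult E′ v j + mult E′ j v)
        ≡⟨ cong₂ _+_ (degree E v) (degree E′ v) ⟩
      a v + a′ v ∎

  EdgeComb-sum : ∀ {r} {a : Fin r → Fin n → ℕ} {b : Fin r → ℕ} →
    (∀ t → EdgeComb G (a t) (b t)) → EdgeComb G (λ v → sum (λ t → a t v)) (sum b)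
  EdgeComb-sum {zero}  _  = EdgeComb-zero
  EdgeComb-sum {suc r} Es = EdgeComb-+ (Es zero) (EdgeComb-sum (Es ∘ suc))

  EdgeComb-edge : ∀ {i j} → Adj G i j → EdgeComb G (λ v → δ v i + δ v j) 1
  EdgeComb-edge {i} {j} ij = record
    { mult    = μ
    ; onEdges = onEdges′
    ; degree  = λ v → begin
        sum (λ w → δ v i * δ w j + δ w i * δ v j)
          ≡⟨ ∑-distrib-+ {n} _ _ ⟩
        sum (λ w → δ v i * δ w j) + sum (λ w → δ w i * δ v j)
          ≡⟨ cong₂ _+_ (sym (*-distribˡ-sum {n} (δ v i) _)) (sym (*-distribʳ-sum {n} (δ v j) _)) ⟩
        δ v i * sum (λ w → δ w j) + sum (λ w → δ w i) * δ v j
          ≡⟨ cong₂ _+_ (cong (δ v i *_) (sum-δ j)) (cong (_* δ v j) (sum-δ i)) ⟩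
        δ v i * 1 + 1 * δ v j
          ≡⟨ cong₂ _+_ (ℕP.*-identityʳ (δ v i)) (ℕP.*-identityˡ (δ v j)) ⟩
        δ v i + δ v j ∎
    ; size    = begin
        sum (λ u → sum (λ w → δ u i * δ w j))  ≡⟨ sum-cong-≗ {n} (λ u → sym (*-distribˡ-sum {n} (δ u i) _)) ⟩
        sum (λ u → δ u i * sum (λ w → δ w j))  ≡⟨ sum-cong-≗ {n} (λ u → cong (δ u i *_) (sum-δ j)) ⟩
        sum (λ u → δ u i * 1)                  ≡⟨ sum-cong-≗ {n} (λ u → ℕP.*-identityʳ (δ u i)) ⟩
        sum (λ u → δ u i)                      ≡⟨ sum-δ i ⟩
        1                                      ∎
    }
    where
    open ≡-Reasoning
    μ : Fin n → Fin n → ℕ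
    μ u w = δ u i * δ w j
    onEdges′ : ∀ u w → ¬ Adj G u w → μ u w ≡ 0
    onEdges′ u w ¬uw with u ≟ i | w ≟ j
    ... | yes refl | yes refl = contradiction ij ¬uw
    ... | yes _    | no _     = refl
    ... | no _     | _        = refl

  EdgeComb-weighted : ∀ {a b} (E : EdgeComb G a b) (w : Fin n → ℕ) →
    sum (λ v → w v * a v) ≡ sum (λ i → sum (λ j → (w i + w j) * mult E i j))
  EdgeComb-weighted {a} E w = begin
    sum (λ v → w v * a v)
      ≡⟨ sum-cong-≗ {n} (λ v → cong (w v *_) (sym (degree E v))) ⟩
    sum (λ v → w v * sum (λ j → μ v j + μ j v))
      ≡⟨ sum-cong-≗ {n} (λ v → trans (*-distribˡ-sum {n} (w v) _)
                                      (sum-cong-≗ {n} (λ j → ℕP.*-distribˡ-+ (w v) (μ v j) (μ j v)))) ⟩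
    sum (λ v → sum (λ j → w v * μ v j + w v * μ j v))
      ≡⟨ sum-cong-≗ {n} (λ v → ∑-distrib-+ {n} _ _) ⟩
    sum (λ v → sum (λ j → w v * μ v j) + sum (λ j → w v * μ j v))
      ≡⟨ ∑-distrib-+ {n} _ _ ⟩
    sum (λ v → sum (λ j → w v * μ v j)) + sum (λ v → sum (λ j → w v * μ j v))
      ≡⟨ cong (sum (λ v → sum (λ j → w v * μ v j)) +_) (∑-comm (λ v j → w v * μ j v)) ⟩
    sum (λ i → sum (λ j → w i * μ i j)) + sum (λ i → sum (λ j → w j * μ i j))
      ≡⟨ sym (∑-distrib-+ {n} _ _) ⟩
    sum (λ i → sum (λ j → w i * μ i j) + sum (λ j → w j * μ i j))
      ≡⟨ sum-cong-≗ {n} (λ i → trans (sym (∑-distrib-+ {n} _ _))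
                                      (sum-cong-≗ {n} (λ j → sym (ℕP.*-distribʳ-+ (μ i j) (w i) (w j))))) ⟩
    sum (λ i → sum (λ j → (w i + w j) * μ i j)) ∎
    where
    open ≡-Reasoning
    μ = mult E

  EdgeComb-handshake : ∀ {a b} → EdgeComb G a b → sum a ≡ 2 * b
  EdgeComb-handshake {a} {b} E = begin
    sum a                                   ≡⟨ sum-cong-≗ {n} (λ v → sym (ℕP.*-identityˡ (a v))) ⟩
    sum (λ v → 1 * a v)                     ≡⟨ EdgeComb-weighted E (λ _ → 1) ⟩
    sum (λ i → sum (λ j → 2 * mult E i j))  ≡⟨ sum-cong-≗ {n} (λ i → sym (*-distribˡ-sum {n} 2 (mult E i))) ⟩
    sum (λ i → 2 * sum (mult E i))          ≡⟨ sym (*-distribˡ-sum {n} 2 _) ⟩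
    2 * sum (λ i → sum (mult E i))          ≡⟨ cong (2 *_) (size E) ⟩
    2 * b                                   ∎
    where open ≡-Reasoning

  EdgeComb-weight-≤ : ∀ {a b} (w : Fin n → ℕ) {K} → (∀ i j → Adj G i j → w i + w j ≤ K) →
    EdgeComb G a b → sum (λ v → w v * a v) ≤ K * b
  EdgeComb-weight-≤ {a} {b} w {K} edge-≤ E = begin
    sum (λ v → w v * a v)
      ≡⟨ EdgeComb-weighted E w ⟩
    sum (λ i → sum (λ j → (w i + w j) * mult E i j))
      ≤⟨ sum-mono-≤ (λ i → sum-mono-≤ (λ j → pair-≤ i j (T? (adj G i j)))) ⟩
    sum (λ i → sum (λ j → K * mult E i j))
      ≡⟨ sum-cong-≗ {n} (λ i → sym (*-distribˡ-sum {n} K (mult E i))) ⟩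
    sum (λ i → K * sum (mult E i))
      ≡⟨ sym (*-distribˡ-sum {n} K _) ⟩
    K * sum (λ i → sum (mult E i))
      ≡⟨ cong (K *_) (size E) ⟩
    K * b ∎
    where
    open ℕP.≤-Reasoning
    pair-≤ : ∀ i j → Dec (Adj G i j) → (w i + w j) * mult E i j ≤ K * mult E i j
    pair-≤ i j (yes ij) = ℕP.*-monoˡ-≤ (mult E i j) (edge-≤ i j ij)
    pair-≤ i j (no ¬ij) rewrite onEdges E i j ¬ij | ℕP.*-zeroʳ (w i + w j) = z≤n

  edgePart-comb : ∀ {A} → IsEdgePart G A → EdgeComb G (χ A) 1
  edgePart-comb {A} (a , b , ab , A≡ab) = EdgeComb-cong degree-eq refl (EdgeComb-edge ab)
    where
    degree-eq : ∀ v → δ v a + δ v b ≡ χ A v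
    degree-eq v with v ∈? A
    ... | no v∉A = cong₂ _+_ (𝟙-no (v ≟ a) (v∉A ∘ Equivalence.from (A≡ab v) ∘ inj₁))
                             (𝟙-no (v ≟ b) (v∉A ∘ Equivalence.from (A≡ab v) ∘ inj₂))
    ... | yes v∈A with Equivalence.to (A≡ab v) v∈A
    ...   | inj₁ refl = cong₂ _+_ (𝟙-yes (v ≟ v) refl) (𝟙-no (v ≟ b) (Adj-irrefl G ab))
    ...   | inj₂ refl = cong₂ _+_ (𝟙-no (v ≟ a) (Adj-irrefl G ab ∘ sym)) (𝟙-yes (v ≟ v) refl)

  closedWalk-comb : ∀ {m} (g : Fin (suc m) → Fin n) → IsClosedWalk G g →
    EdgeComb G (λ v → occ g v + occ g v) (suc m)
  closedWalk-comb {m} g walk =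
    EdgeComb-cong degree-eq (sum-ones (suc m)) (EdgeComb-sum (λ t → EdgeComb-edge (walk t)))
    where
    degree-eq : ∀ v → sum (λ t → δ v (g t) + δ v (g (next t))) ≡ occ g v + occ g v
    degree-eq v = trans (∑-distrib-+ (λ t → δ v (g t)) (λ t → δ v (g (next t))))
                        (cong (occ g v +_) (occ-rotate g v))

  𝟙+e-size : ∀ {x b c} → EdgeComb G (λ v → 1 + δ v x) b → 2 * c ≡ suc n → b ≡ c
  𝟙+e-size {x} {b} {c} E 2c≡1+n = ℕP.*-cancelˡ-≡ b c 2 (begin
    2 * b                                   ≡⟨ sym (EdgeComb-handshake E) ⟩
    sum (λ v → 1 + δ v x)                   ≡⟨ ∑-distrib-+ {n} _ _ ⟩
    sum {n} (λ _ → 1) + sum (λ v → δ v x)   ≡⟨ cong₂ _+_ (sum-ones n) (sum-δ x) ⟩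
    n + 1                                   ≡⟨ ℕP.+-comm n 1 ⟩
    suc n                                   ≡⟨ sym 2c≡1+n ⟩
    2 * c                                   ∎)
    where open ≡-Reasoning

record ℕComb {n} (G : Graph n) (a : Fin n → ℕ) (b : ℕ) : Set where
  field
    vertexCoeff  : Fin n → ℕ
    tCoeff       : ℕ
    {edgeDegree} : Fin n → ℕ
    {edgeCount}  : ℕ
    edges        : EdgeComb G edgeDegree edgeCount
    degree-split : ∀ v → vertexCoeff v + edgeDegree v ≡ a v
    size-split   : sum vertexCoeff + edgeCount + tCoeff ≡ b

open ℕComb

ℕComb-weight-≤ : ∀ {n} {G : Graph n} {a b} (w : Fin n → ℕ) {K} → (∀ v → w v ≤ K) →
  (∀ i j → Adj G i j → w i + w j ≤ K) → ℕComb G a b → sum (λ v → w v * a v) ≤ K * b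
ℕComb-weight-≤ {n} {a = a} {b} w {K} vertex-≤ edge-≤ C = begin
  sum (λ v → w v * a v)
    ≡⟨ sum-cong-≗ {n} (λ v → trans (cong (w v *_) (sym (degree-split C v)))
                                    (ℕP.*-distribˡ-+ (w v) (l v) (a′ v))) ⟩
  sum (λ v → w v * l v + w v * a′ v)
    ≡⟨ ∑-distrib-+ {n} _ _ ⟩
  sum (λ v → w v * l v) + sum (λ v → w v * a′ v)
    ≤⟨ ℕP.+-mono-≤ (sum-mono-≤ (λ v → ℕP.*-monoˡ-≤ (l v) (vertex-≤ v)))
                   (EdgeComb-weight-≤ w edge-≤ (edges C)) ⟩
  sum (λ v → K * l v) + K * edgeCount C
    ≡⟨ cong (_+ K * edgeCount C) (sym (*-distribˡ-sum {n} K l)) ⟩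
  K * sum l + K * edgeCount C
    ≡⟨ sym (ℕP.*-distribˡ-+ K (sum l) (edgeCount C)) ⟩
  K * (sum l + edgeCount C)
    ≤⟨ ℕP.*-monoʳ-≤ K (ℕP.m≤m+n _ (tCoeff C)) ⟩
  K * (sum l + edgeCount C + tCoeff C)
    ≡⟨ cong (K *_) (size-split C) ⟩
  K * b ∎
  where
  open ℕP.≤-Reasoning
  l  = vertexCoeff C
  a′ = edgeDegree C

ℕComb-apart-size : ∀ {n} {G : Graph n} {M} {f : Fin M → Fin n} → Injective _≡_ _≡_ f → ∀ {x} →
  (∀ t → f t ≢ x) → (∀ t → ¬ Adj G x (f t)) →
  ∀ {b} → ℕComb G (λ v → occ f v + δ v x) b → M + 2 ≤ 2 * b
ℕComb-apart-size {n} {G} {M} {f} f-inj {x} x∉f x≁f {b} C = begin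
  M + 2                                  ≡⟨ sym (cong₂ _+_ (sum-occ f) (cong (2 *_) (sum-δ x))) ⟩
  sum (occ f) + 2 * sum (λ v → δ v x)    ≡⟨ cong (sum (occ f) +_) (*-distribˡ-sum {n} 2 _) ⟩
  sum (occ f) + sum (λ v → 2 * δ v x)    ≡⟨ sym (∑-distrib-+ {n} _ _) ⟩
  sum w                                  ≡⟨ sum-cong-≗ {n} (λ v → sym (w*A≡w v)) ⟩
  sum (λ v → w v * (r v + δ v x))        ≤⟨ ℕComb-weight-≤ w w≤2 edge-≤ C ⟩
  2 * b                                  ∎
  where
  open ℕP.≤-Reasoning
  r : Fin n → ℕ
  r = occ f
  w : Fin n → ℕ
  w v = r v + 2 * δ v x
  r-x : r x ≡ 0
  r-x = occ-∉ x∉f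
  r-nbr : ∀ {j} → Adj G x j → r j ≡ 0
  r-nbr xj = occ-∉ (λ t ft≡j → x≁f t (subst (Adj G x) (sym ft≡j) xj))
  w-x : w x ≡ 2
  w-x = cong₂ (λ ρ d → ρ + 2 * d) r-x (𝟙-yes (x ≟ x) refl)
  w-off : ∀ {v} → v ≢ x → w v ≡ r v
  w-off {v} v≢x = trans (cong (λ d → r v + 2 * d) (𝟙-no (v ≟ x) v≢x)) (ℕP.+-identityʳ (r v))
  w*A≡w : ∀ v → w v * (r v + δ v x) ≡ w v
  w*A≡w v with v ≟ x
  ... | yes refl rewrite r-x = refl
  ... | no _     rewrite ℕP.+-identityʳ (r v) = idem (occ-≤1 f-inj v)
    where
    idem : ∀ {m} → m ≤ 1 → m * m ≡ m
    idem z≤n       = refl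
    idem (s≤s z≤n) = refl
  w≤2 : ∀ v → w v ≤ 2
  w≤2 v = by-cases (v ≟ x)
    where
    by-cases : Dec (v ≡ x) → w v ≤ 2
    by-cases (yes refl) = ℕP.≤-reflexive w-x
    by-cases (no v≢x)   = ℕP.≤-trans (ℕP.≤-reflexive (w-off v≢x)) (ℕP.≤-trans (occ-≤1 f-inj v) (s≤s z≤n))
  edge-≤ : ∀ i j → Adj G i j → w i + w j ≤ 2
  edge-≤ i j ij = by-cases (i ≟ x) (j ≟ x)
    where
    by-cases : Dec (i ≡ x) → Dec (j ≡ x) → w i + w j ≤ 2
    by-cases (yes refl) (yes refl) = contradiction refl (Adj-irrefl G ij)
    by-cases (yes refl) (no j≢x)   = ℕP.≤-reflexive (cong₂ _+_ w-x (trans (w-off j≢x) (r-nbr ij)))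
    by-cases (no i≢x)   (yes refl) = ℕP.≤-reflexive (cong₂ _+_ (trans (w-off i≢x) (r-nbr (Adj-sym G ij))) w-x)
    by-cases (no i≢x)   (no j≢x)   = ℕP.≤-trans (ℕP.≤-reflexive (cong₂ _+_ (w-off i≢x) (w-off j≢x)))
                                                (ℕP.+-mono-≤ (occ-≤1 f-inj i) (occ-≤1 f-inj j))

-- Rational points, ℕB and the cone

toℚ : ℕ → ℚ
toℚ k = ℤ.+ k / 1

ℕPt : ∀ {n} → (Fin n → ℕ) → ℕ → Pt n
ℕPt a b = (λ i → toℚ (a i)) , toℚ b

mkℚ₁ : ℤ.ℤ → ℚ
mkℚ₁ z = mkℚ z 0 (Coprime.sym (1-coprimeTo _))

/1≡mkℚ₁ : ∀ z → z / 1 ≡ mkℚ₁ z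
/1≡mkℚ₁ z = ℚP.↥p/↧p≡p (mkℚ₁ z)

/1-+ : ∀ z w → (z / 1) ℚ.+ (w / 1) ≡ (z ℤ.+ w) / 1
/1-+ z w rewrite /1≡mkℚ₁ z | /1≡mkℚ₁ w | /1≡mkℚ₁ (z ℤ.+ w) =
  ℚP.toℚᵘ-injective (ℚᵘP.≃-trans (ℚP.toℚᵘ-homo-+ (mkℚ₁ z) (mkℚ₁ w))
    (*≡* (cong (ℤ._* ℤ.+ 1) (cong₂ ℤ._+_ (ℤP.*-identityʳ z) (ℤP.*-identityʳ w)))))

/1-neg : ∀ z → ℚ.- (z / 1) ≡ (ℤ.- z) / 1
/1-neg z rewrite /1≡mkℚ₁ z | /1≡mkℚ₁ (ℤ.- z) = mkℚ₁-neg z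
  where
  mkℚ₁-neg : ∀ z → ℚ.- mkℚ₁ z ≡ mkℚ₁ (ℤ.- z)
  mkℚ₁-neg (ℤ.+ zero)  = refl
  mkℚ₁-neg (ℤ.+ suc _) = refl
  mkℚ₁-neg -[1+ _ ]    = refl

toℚ-+ : ∀ m k → toℚ (m + k) ≡ toℚ m ℚ.+ toℚ k
toℚ-+ m k = sym (/1-+ (ℤ.+ m) (ℤ.+ k))

toℚ-+-cancelˡ : ∀ m k → toℚ (m + k) ℚ.- toℚ m ≡ toℚ k
toℚ-+-cancelˡ m k = trans (cong (ℚ._- toℚ m) (toℚ-+ m k)) (+-cancelˡ (toℚ m) (toℚ k))
  where
  +-cancelˡ : ∀ x y → x ℚ.+ y ℚ.- x ≡ y
  +-cancelˡ = solve 2 (λ x y → x :+ y :- x := y) refl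
    where open ℚS.+-*-Solver

toℚ-injective : ∀ {m k} → toℚ m ≡ toℚ k → m ≡ k
toℚ-injective {m} {k} eq rewrite /1≡mkℚ₁ (ℤ.+ m) | /1≡mkℚ₁ (ℤ.+ k) = ℤP.+-injective (cong ℚ.↥_ eq)

toℚ-nonNeg : ∀ k → NonNeg (toℚ k)
toℚ-nonNeg k = ℚP.nonNegative⁻¹ (toℚ k) {{ℚP.normalize-nonNeg k 1}}

∑-cong : ∀ n {f g : Fin n → ℚ} → (∀ i → f i ≡ g i) → ∑ n f ≡ ∑ n g
∑-cong zero    _   = refl
∑-cong (suc n) f≗g = cong₂ ℚ._+_ (f≗g zero) (∑-cong n (f≗g ∘ suc))

∑-toℚ : ∀ n (f : Fin n → ℕ) → ∑ n (toℚ ∘ f) ≡ toℚ (sum f)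
∑-toℚ zero    _ = refl
∑-toℚ (suc n) f = trans (cong (toℚ (f zero) ℚ.+_) (∑-toℚ n (f ∘ suc))) (sym (toℚ-+ (f zero) _))

∑-*ˡ : ∀ n x (f : Fin n → ℚ) → ∑ n (λ i → x ℚ.* f i) ≡ x ℚ.* ∑ n f
∑-*ˡ zero    x _ = sym (ℚP.*-zeroʳ x)
∑-*ˡ (suc n) x f = trans (cong (x ℚ.* f zero ℚ.+_) (∑-*ˡ n x (f ∘ suc))) (sym (ℚP.*-distribˡ-+ x (f zero) _))

∑-zero : ∀ n → ∑ n (λ _ → 0ℚ) ≡ 0ℚ
∑-zero zero    = refl
∑-zero (suc n) = cong (0ℚ ℚ.+_) (∑-zero n)

IsInt-+ : ∀ {x y} → IsInt x → IsInt y → IsInt (x ℚ.+ y)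
IsInt-+ (z , refl) (w , refl) = z ℤ.+ w , /1-+ z w

IsInt-neg : ∀ {x} → IsInt x → IsInt (ℚ.- x)
IsInt-neg (z , refl) = ℤ.- z , /1-neg z

IsInt-∑ : ∀ n (f : Fin n → ℚ) → (∀ i → IsInt (f i)) → IsInt (∑ n f)
IsInt-∑ zero    _ _     = ℤ.+ 0 , refl
IsInt-∑ (suc n) f f-int = IsInt-+ (f-int zero) (IsInt-∑ n (f ∘ suc) (f-int ∘ suc))

module _ {n : ℕ} where

  ≐-sym : {p q : Pt n} → p ≐ q → q ≐ p
  ≐-sym (a≗a′ , b≡b′) = sym ∘ a≗a′ , sym b≡b′

  ≐-trans : {p q r : Pt n} → p ≐ q → q ≐ r → p ≐ r
  ≐-trans (a≗a′ , b≡b′) (a′≗a″ , b′≡b″) = (λ i → trans (a≗a′ i) (a′≗a″ i)) , trans b≡b′ b′≡b″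

  ℕPt-cong : ∀ {a a′ : Fin n → ℕ} {b b′} → (∀ i → a i ≡ a′ i) → b ≡ b′ → ℕPt a b ≐ ℕPt a′ b′
  ℕPt-cong a≗a′ b≡b′ = cong toℚ ∘ a≗a′ , cong toℚ b≡b′

  InSpan-resp-≐ : ∀ {G : Graph n} {P : ℚ → Set} {p q} → InSpan G P p → p ≐ q → InSpan G P q
  InSpan-resp-≐ (l , μ , ν , l∈P , μ∈P , ν∈P , onEdges′ , combo≐p) p≐q =
    l , μ , ν , l∈P , μ∈P , ν∈P , onEdges′ , ≐-trans combo≐p p≐q

  InNB⊆InCone : ∀ {G : Graph n} {p} → InNB G p → InCone G p
  InNB⊆InCone (l , μ , ν , l∈ℕ , μ∈ℕ , ν∈ℕ , onEdges′ , combo≐p) =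
    l , μ , ν , nonNeg ∘ l∈ℕ , (λ i j → nonNeg (μ∈ℕ i j)) , nonNeg ν∈ℕ , onEdges′ , combo≐p
    where
    nonNeg : ∀ {q} → IsNat q → NonNeg q
    nonNeg (k , refl) = toℚ-nonNeg k

  combo-cong : ∀ {l l′ μ μ′ ν ν′} → (∀ i → l i ≡ l′ i) → (∀ i j → μ i j ≡ μ′ i j) → ν ≡ ν′ →
    combo {n} l μ ν ≐ combo l′ μ′ ν′
  combo-cong l≗l′ μ≗μ′ ν≡ν′ =
    (λ i → cong₂ ℚ._+_ (l≗l′ i) (∑-cong n (λ j → cong₂ ℚ._+_ (μ≗μ′ i j) (μ≗μ′ j i)))) ,
    cong₂ ℚ._+_ (cong₂ ℚ._+_ (∑-cong n l≗l′) (∑-cong n (λ i → ∑-cong n (μ≗μ′ i)))) ν≡ν′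

  combo-toℚ : ∀ (l : Fin n → ℕ) (μ : Fin n → Fin n → ℕ) ν →
    combo (toℚ ∘ l) (λ i j → toℚ (μ i j)) (toℚ ν) ≐
    ℕPt (λ i → l i + sum (λ j → μ i j + μ j i)) (sum l + sum (λ i → sum (μ i)) + ν)
  combo-toℚ l μ ν = degree-eq , size-eq
    where
    open ≡-Reasoning
    degree-eq : ∀ i → toℚ (l i) ℚ.+ ∑ n (λ j → toℚ (μ i j) ℚ.+ toℚ (μ j i)) ≡
                      toℚ (l i + sum (λ j → μ i j + μ j i))
    degree-eq i = begin
      toℚ (l i) ℚ.+ ∑ n (λ j → toℚ (μ i j) ℚ.+ toℚ (μ j i))
        ≡⟨ cong (toℚ (l i) ℚ.+_) (trans (∑-cong n (λ j → sym (toℚ-+ (μ i j) (μ j i)))) (∑-toℚ n _)) ⟩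
      toℚ (l i) ℚ.+ toℚ (sum (λ j → μ i j + μ j i))
        ≡⟨ sym (toℚ-+ (l i) _) ⟩
      toℚ (l i + sum (λ j → μ i j + μ j i)) ∎
    size-eq : ∑ n (toℚ ∘ l) ℚ.+ ∑ n (λ i → ∑ n (λ j → toℚ (μ i j))) ℚ.+ toℚ ν ≡
              toℚ (sum l + sum (λ i → sum (μ i)) + ν)
    size-eq = begin
      ∑ n (toℚ ∘ l) ℚ.+ ∑ n (λ i → ∑ n (λ j → toℚ (μ i j))) ℚ.+ toℚ ν
        ≡⟨ cong (λ x → ∑ n (toℚ ∘ l) ℚ.+ x ℚ.+ toℚ ν)
                (trans (∑-cong n (λ i → ∑-toℚ n (μ i))) (∑-toℚ n _)) ⟩
      ∑ n (toℚ ∘ l) ℚ.+ toℚ (sum (λ i → sum (μ i))) ℚ.+ toℚ ν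
        ≡⟨ cong (λ x → x ℚ.+ toℚ (sum (λ i → sum (μ i))) ℚ.+ toℚ ν) (∑-toℚ n l) ⟩
      toℚ (sum l) ℚ.+ toℚ (sum (λ i → sum (μ i))) ℚ.+ toℚ ν
        ≡⟨ cong (ℚ._+ toℚ ν) (sym (toℚ-+ (sum l) _)) ⟩
      toℚ (sum l + sum (λ i → sum (μ i))) ℚ.+ toℚ ν
        ≡⟨ sym (toℚ-+ (sum l + sum (λ i → sum (μ i))) ν) ⟩
      toℚ (sum l + sum (λ i → sum (μ i)) + ν) ∎

  ℕComb⇒InNB : ∀ {G : Graph n} {a b} → ℕComb G a b → InNB G (ℕPt a b)
  ℕComb⇒InNB {a = a} {b} C =
    toℚ ∘ l , (λ i j → toℚ (μ i j)) , toℚ (tCoeff C) ,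
    (λ i → l i , refl) , (λ i j → μ i j , refl) , (tCoeff C , refl) ,
    (λ i j ¬ij → cong toℚ (onEdges (edges C) i j ¬ij)) ,
    ≐-trans (combo-toℚ l μ (tCoeff C))
      (ℕPt-cong (λ i → trans (cong (l i +_) (degree (edges C) i)) (degree-split C i))
                (trans (cong (λ x → sum l + x + tCoeff C) (size (edges C))) (size-split C)))
    where
    l = vertexCoeff C
    μ = mult (edges C)

  InNB⇒ℕComb : ∀ {G : Graph n} {a b} → InNB G (ℕPt a b) → ℕComb G a b
  InNB⇒ℕComb {G} (l , μ , ν , l∈ℕ , μ∈ℕ , ν∈ℕ , onEdges′ , combo≐p) = record
    { vertexCoeff  = L
    ; tCoeff       = N
    ; edges        = E
    ; degree-split = λ i → toℚ-injective (proj₁ ℕPt≐p i)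
    ; size-split   = toℚ-injective (proj₂ ℕPt≐p)
    }
    where
    L : Fin n → ℕ
    L i = proj₁ (l∈ℕ i)
    M : Fin n → Fin n → ℕ
    M i j = proj₁ (μ∈ℕ i j)
    N = proj₁ ν∈ℕ
    E : EdgeComb G (λ i → sum (λ j → M i j + M j i)) (sum (λ i → sum (M i)))
    E = record
      { mult    = M
      ; onEdges = λ i j ¬ij → toℚ-injective (trans (sym (proj₂ (μ∈ℕ i j))) (onEdges′ i j ¬ij))
      ; degree  = λ _ → refl
      ; size    = refl
      }
    ℕPt≐p = ≐-trans (≐-sym (combo-toℚ L M N))
              (≐-trans (combo-cong (sym ∘ proj₂ ∘ l∈ℕ) (λ i j → sym (proj₂ (μ∈ℕ i j))) (sym (proj₂ ν∈ℕ)))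
                       combo≐p)

  scale : ℚ → Pt n → Pt n
  scale q (a , b) = (λ i → q ℚ.* a i) , q ℚ.* b

  double : Pt n → Pt n
  double (a , b) = (λ i → a i ℚ.+ a i) , b ℚ.+ b

  scale-resp-≐ : ∀ q {p p′} → p ≐ p′ → scale q p ≐ scale q p′
  scale-resp-≐ q (a≗a′ , b≡b′) = cong (q ℚ.*_) ∘ a≗a′ , cong (q ℚ.*_) b≡b′

  combo-scale : ∀ q l μ ν →
    combo {n} (λ i → q ℚ.* l i) (λ i j → q ℚ.* μ i j) (q ℚ.* ν) ≐ scale q (combo l μ ν)
  combo-scale q l μ ν = degree-eq , size-eq
    where
    open ≡-Reasoning
    degree-eq : ∀ i → q ℚ.* l i ℚ.+ ∑ n (λ j → q ℚ.* μ i j ℚ.+ q ℚ.* μ j i) ≡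
                      q ℚ.* (l i ℚ.+ ∑ n (λ j → μ i j ℚ.+ μ j i))
    degree-eq i = begin
      q ℚ.* l i ℚ.+ ∑ n (λ j → q ℚ.* μ i j ℚ.+ q ℚ.* μ j i)
        ≡⟨ cong (q ℚ.* l i ℚ.+_)
                (trans (∑-cong n (λ j → sym (ℚP.*-distribˡ-+ q (μ i j) (μ j i)))) (∑-*ˡ n q _)) ⟩
      q ℚ.* l i ℚ.+ q ℚ.* ∑ n (λ j → μ i j ℚ.+ μ j i)
        ≡⟨ sym (ℚP.*-distribˡ-+ q (l i) _) ⟩
      q ℚ.* (l i ℚ.+ ∑ n (λ j → μ i j ℚ.+ μ j i)) ∎
    size-eq : ∑ n (λ i → q ℚ.* l i) ℚ.+ ∑ n (λ i → ∑ n (λ j → q ℚ.* μ i j)) ℚ.+ q ℚ.* ν ≡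
              q ℚ.* (∑ n l ℚ.+ ∑ n (λ i → ∑ n (μ i)) ℚ.+ ν)
    size-eq = begin
      ∑ n (λ i → q ℚ.* l i) ℚ.+ ∑ n (λ i → ∑ n (λ j → q ℚ.* μ i j)) ℚ.+ q ℚ.* ν
        ≡⟨ cong₂ (λ x y → x ℚ.+ y ℚ.+ q ℚ.* ν) (∑-*ˡ n q l)
                 (trans (∑-cong n (λ i → ∑-*ˡ n q (μ i))) (∑-*ˡ n q _)) ⟩
      q ℚ.* ∑ n l ℚ.+ q ℚ.* ∑ n (λ i → ∑ n (μ i)) ℚ.+ q ℚ.* ν
        ≡⟨ cong (ℚ._+ q ℚ.* ν) (sym (ℚP.*-distribˡ-+ q (∑ n l) _)) ⟩
      q ℚ.* (∑ n l ℚ.+ ∑ n (λ i → ∑ n (μ i))) ℚ.+ q ℚ.* ν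
        ≡⟨ sym (ℚP.*-distribˡ-+ q _ ν) ⟩
      q ℚ.* (∑ n l ℚ.+ ∑ n (λ i → ∑ n (μ i)) ℚ.+ ν) ∎

  InCone-scale : ∀ {G : Graph n} q .{{_ : ℚ.NonNegative q}} {p} → InCone G p → InCone G (scale q p)
  InCone-scale q (l , μ , ν , l≥0 , μ≥0 , ν≥0 , onEdges′ , combo≐p) =
    (λ i → q ℚ.* l i) , (λ i j → q ℚ.* μ i j) , q ℚ.* ν ,
    scale-nonNeg ∘ l≥0 , (λ i j → scale-nonNeg (μ≥0 i j)) , scale-nonNeg ν≥0 ,
    (λ i j ¬ij → trans (cong (q ℚ.*_) (onEdges′ i j ¬ij)) (ℚP.*-zeroʳ q)) ,
    ≐-trans (combo-scale q l μ ν) (scale-resp-≐ q combo≐p)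
    where
    scale-nonNeg : ∀ {x} → NonNeg x → NonNeg (q ℚ.* x)
    scale-nonNeg {x} x≥0 = subst (ℚ._≤ q ℚ.* x) (ℚP.*-zeroʳ q) (ℚP.*-monoˡ-≤-nonNeg q {0ℚ} {x} x≥0)

  ½-double : ∀ x → ½ ℚ.* (x ℚ.+ x) ≡ x
  ½-double = solve 1 (λ x → con ½ :* (x :+ x) := x) refl
    where open ℚS.+-*-Solver

  InCone-halve : ∀ {G : Graph n} {p} → InCone G (double p) → InCone G p
  InCone-halve {G} {a , b} cone =
    InSpan-resp-≐ {G = G} {P = NonNeg} (InCone-scale {G = G} ½ {double (a , b)} cone)
      ((λ i → ½-double (a i)) , ½-double b)

  InInterior-halve : ∀ {G : Graph n} a b → InInterior G (double (a , b)) → InInterior G (a , b)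
  InInterior-halve {G} a b (ε , ε>0 , ball⊆cone) =
    ½ ℚ.* ε , ℚP.*-monoʳ-<-pos ½ {0ℚ} {ε} ε>0 ,
    λ (q , t) q≈a t≈b → InCone-halve {G} {q , t}
      (ball⊆cone (double (q , t)) (λ i → double-close {q i} {a i} (q≈a i)) (double-close {t} {b} t≈b))
    where
    double-close : ∀ {x y} → ℚ.∣ x ℚ.- y ∣ ℚ.< ½ ℚ.* ε → ℚ.∣ (x ℚ.+ x) ℚ.- (y ℚ.+ y) ∣ ℚ.< ε
    double-close {x} {y} close = begin-strict
      ℚ.∣ (x ℚ.+ x) ℚ.- (y ℚ.+ y) ∣     ≡⟨ cong ℚ.∣_∣ (diff-double x y) ⟩
      ℚ.∣ d ℚ.+ d ∣                      ≤⟨ ℚP.∣p+q∣≤∣p∣+∣q∣ d d ⟩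
      ℚ.∣ d ∣ ℚ.+ ℚ.∣ d ∣                <⟨ ℚP.+-mono-< close close ⟩
      ½ ℚ.* ε ℚ.+ ½ ℚ.* ε                ≡⟨ ½-sum ε ⟩
      ε                                  ∎
      where
      open ℚP.≤-Reasoning
      open ℚS.+-*-Solver
      d = x ℚ.- y
      diff-double : ∀ x y → (x ℚ.+ x) ℚ.- (y ℚ.+ y) ≡ (x ℚ.- y) ℚ.+ (x ℚ.- y)
      diff-double = solve 2 (λ x y → (x :+ x) :- (y :+ y) := (x :- y) :+ (x :- y)) refl
      ½-sum : ∀ x → ½ ℚ.* x ℚ.+ ½ ℚ.* x ≡ x
      ½-sum = solve 1 (λ x → con ½ :* x :+ con ½ :* x := x) refl

  IntPt⇒InZB : ∀ {G : Graph n} {p} → IntPt p → InZB G p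
  IntPt⇒InZB {p = a , b} (a∈ℤ , b∈ℤ) =
    a , (λ _ _ → 0ℚ) , b ℚ.- ∑ n a ,
    a∈ℤ , (λ _ _ → ℤ.+ 0 , refl) , IsInt-+ b∈ℤ (IsInt-neg (IsInt-∑ n a a∈ℤ)) , (λ _ _ _ → refl) ,
    (λ i → trans (cong (a i ℚ.+_) (∑-zero n)) (ℚP.+-identityʳ (a i))) ,
    trans (cong (λ x → ∑ n a ℚ.+ x ℚ.+ (b ℚ.- ∑ n a)) (trans (∑-cong n (λ _ → ∑-zero n)) (∑-zero n)))
          (+0+-cancel (∑ n a) b)
    where
    +0+-cancel : ∀ x y → x ℚ.+ 0ℚ ℚ.+ (y ℚ.- x) ≡ y
    +0+-cancel = solve 2 (λ x y → x :+ con 0ℚ :+ (y :- x) := y) refl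
      where open ℚS.+-*-Solver

  shift : ℕ → Pt n → Pt n
  shift c p = (λ i → proj₁ p i ℚ.- 1ℚ) , proj₂ p ℚ.- toℚ c

-- OmegaPrincipal G unfolds to Σ c, 2c ≡ n + 1 × ΩAt G c.
ΩAt : ∀ {n} → Graph n → ℕ → Set
ΩAt {n} G c = ∀ (p : Pt n) → (InNB G p × InInterior G p) ⇔ InNB G (shift c p)

toℚ-shift-double : ∀ m k → toℚ (m + (k + k)) ≡ (toℚ (m + k) ℚ.+ toℚ (m + k)) ℚ.- toℚ m
toℚ-shift-double m k = sym (begin
  (toℚ (m + k) ℚ.+ toℚ (m + k)) ℚ.- toℚ m   ≡⟨ cong (ℚ._- toℚ m) (sym (toℚ-+ (m + k) (m + k))) ⟩
  toℚ ((m + k) + (m + k)) ℚ.- toℚ m         ≡⟨ cong (λ x → toℚ x ℚ.- toℚ m) (regroup m k) ⟩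
  toℚ (m + (m + (k + k))) ℚ.- toℚ m         ≡⟨ toℚ-+-cancelˡ m (m + (k + k)) ⟩
  toℚ (m + (k + k))                         ∎)
  where
  open ≡-Reasoning
  regroup : ∀ m k → (m + k) + (m + k) ≡ m + (m + (k + k))
  regroup = solve 2 (λ m k → (m :+ k) :+ (m :+ k) := m :+ (m :+ (k :+ k))) refl
    where open +-*-Solver

ℕComb-halve : ∀ {n} {G : Graph n} {c} → Normal G → ΩAt G c → ∀ {a b} →
  ℕComb G (λ v → 1 + (a v + a v)) (c + (b + b)) → ℕComb G a b
ℕComb-halve {n} {G} {c} normal Ω {a} {b} C =
  InNB⇒ℕComb (InSpan-resp-≐ {G = G} (Equivalence.to (Ω q) (q∈ℕB , q∈interior)) shift-q≐)
  where
  q : Pt n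
  q = ℕPt (λ v → 1 + a v) (c + b)
  q-int : IntPt q
  q-int = (λ v → ℤ.+ (1 + a v) , refl) , (ℤ.+ (c + b) , refl)
  shift-2q≐ : ℕPt (λ v → 1 + (a v + a v)) (c + (b + b)) ≐ shift c (double q)
  shift-2q≐ = (λ v → toℚ-shift-double 1 (a v)) , toℚ-shift-double c b
  2q∈ℕB×interior : InNB G (double q) × InInterior G (double q)
  2q∈ℕB×interior = Equivalence.from (Ω (double q)) (InSpan-resp-≐ {G = G} (ℕComb⇒InNB C) shift-2q≐)
  q∈interior : InInterior G q
  q∈interior = InInterior-halve {G = G} _ _ (proj₂ 2q∈ℕB×interior)
  q∈ℕB : InNB G q
  q∈ℕB = normal q q-int (IntPt⇒InZB {G = G} q-int)
           (InCone-halve {G = G} {p = q} (InNB⊆InCone {G = G} (proj₁ 2q∈ℕB×interior)))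
  shift-q≐ : shift c q ≐ ℕPt a b
  shift-q≐ = (λ v → toℚ-+-cancelˡ 1 (a v)) , toℚ-+-cancelˡ c b

-- Matchings in even paths and odd closed walks

evenPath-perfectMatching : ∀ {n} {G : Graph n} k (h : Fin (k * 2) → Fin n) →
  (∀ i j → toℕ j ≡ suc (toℕ i) → Adj G (h i) (h j)) → EdgeComb G (occ h) k
evenPath-perfectMatching zero    h _    = EdgeComb-zero
evenPath-perfectMatching (suc k) h path =
  EdgeComb-cong (λ v → ℕP.+-assoc (δ v (h zero)) (δ v (h (suc zero))) _) refl
    (EdgeComb-+ (EdgeComb-edge (path zero (suc zero) refl))
                (evenPath-perfectMatching k (λ i → h (suc (suc i)))
                  (λ i j j≡1+i → path _ _ (cong (λ d → suc (suc d)) j≡1+i))))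

NearPerfectMatching : ∀ {n M} → Graph n → (Fin M → Fin n) → Fin M → Set
NearPerfectMatching {n} G g u =
  Σ (Fin n → ℕ) λ a → ∃[ b ] EdgeComb G a b × (∀ v → a v + δ v (g u) ≡ occ g v)

module _ {n} {G : Graph n} {k : ℕ} where

  oddClosedWalk-nearPerfect-last : (g : Fin (suc (k * 2)) → Fin n) → IsClosedWalk G g →
    NearPerfectMatching G g (fromℕ (k * 2))
  oddClosedWalk-nearPerfect-last g walk =
    occ (g ∘ inject₁) , k , evenPath-perfectMatching k (g ∘ inject₁) path , λ v → sym (occ-init-last g v)
    where
    path : ∀ i j → toℕ j ≡ suc (toℕ i) → Adj G (g (inject₁ i)) (g (inject₁ j))
    path i j j≡1+i = subst (Adj G (g (inject₁ i)) ∘ g)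
      (trans (next-inject₁ i) (FinP.toℕ-injective (sym (trans (FinP.toℕ-inject₁ j) j≡1+i))))
      (walk (inject₁ i))

  nearPerfect-rotate : ∀ {g : Fin (suc (k * 2)) → Fin n} {u} →
    NearPerfectMatching G (g ∘ next) u → NearPerfectMatching G g (next u)
  nearPerfect-rotate {g} (a , b , E , a+gu≡occ) = a , b , E , λ v → trans (a+gu≡occ v) (occ-rotate g v)

  oddClosedWalk-nearPerfect : (g : Fin (suc (k * 2)) → Fin n) → IsClosedWalk G g →
    ∀ u → NearPerfectMatching G g u
  oddClosedWalk-nearPerfect g walk u =
    subst (NearPerfectMatching G g) (fold-next-toℕ u refl) (rotated (suc (toℕ u)) g walk)
    where
    rotated : ∀ d g → IsClosedWalk G g → NearPerfectMatching G g (fold (fromℕ (k * 2)) next d)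
    rotated zero    g walk = oddClosedWalk-nearPerfect-last g walk
    rotated (suc d) g walk = nearPerfect-rotate {g} (rotated d (g ∘ next) (walk ∘ next))
    fold-next-toℕ : ∀ {m} {d} (u : Fin (suc m)) → toℕ u ≡ d → fold (fromℕ m) next (suc d) ≡ u
    fold-next-toℕ {m}     {zero}  zero    _       = next-fromℕ m
    fold-next-toℕ {suc m} {suc d} (suc u) 1+u≡1+d =
      trans (cong next (fold-next-toℕ {suc m} {d} (inject₁ u)
                          (trans (FinP.toℕ-inject₁ u) (ℕP.suc-injective 1+u≡1+d))))
            (next-inject₁ u)

module _ {n} {G : Graph n} where

  partition-𝟙+e : ∀ {s} {P : Fin (suc s) → Subset n} → IsPartition P → (∀ k → IsEdgePart G (P (inject₁ k))) →
    ∀ {M} {g : Fin M → Fin n} → Injective _≡_ _≡_ g → (∀ v → v ∈ P (fromℕ s) ⇔ (∃[ t ] g t ≡ v)) →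
    ∀ {u x} → NearPerfectMatching G g u → Adj G x (g u) → ∃[ b ] EdgeComb G (λ v → 1 + δ v x) b
  partition-𝟙+e {s} {P} partition edges {g = g} g-inj g-enum {u} {x} (a , b , E , a+gu≡occ) xgu =
    _ , EdgeComb-cong degree-eq refl
          (EdgeComb-+ (EdgeComb-sum (edgePart-comb ∘ edges)) (EdgeComb-+ (EdgeComb-edge xgu) E))
    where
    open ≡-Reasoning
    χ-edges : Fin n → ℕ
    χ-edges v = sum (λ k → χ (P (inject₁ k)) v)
    degree-eq : ∀ v → χ-edges v + ((δ v x + δ v (g u)) + a v) ≡ 1 + δ v x
    degree-eq v = begin
      χ-edges v + ((δ v x + δ v (g u)) + a v)
        ≡⟨ regroup (χ-edges v) (δ v x) (δ v (g u)) (a v) ⟩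
      δ v x + (χ-edges v + (a v + δ v (g u)))
        ≡⟨ cong (λ y → δ v x + (χ-edges v + y)) (trans (a+gu≡occ v) (enumeration-χ g-inj g-enum v)) ⟩
      δ v x + (χ-edges v + χ (P (fromℕ s)) v)
        ≡⟨ cong (δ v x +_) (trans (sym (sum-init-last (λ i → χ (P i) v))) (partition-χ partition v)) ⟩
      δ v x + 1
        ≡⟨ ℕP.+-comm (δ v x) 1 ⟩
      1 + δ v x ∎
      where
      regroup : ∀ s d e a → s + ((d + e) + a) ≡ d + (s + (a + e))
      regroup = solve 4 (λ s d e a → s :+ ((d :+ e) :+ a) := d :+ (s :+ (a :+ e))) refl
        where open +-*-Solver

  closedNbhd-adjacent : ∀ {A m} ((g , _) : IsInducedCycle G A m) → ∀ {x} → InClosedNbhd G A x →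
    ∃[ u ] Adj G x (g u)
  closedNbhd-adjacent C@(g , _ , g-enum , _) {x} (inj₁ x∈A) with Equivalence.to (g-enum x) x∈A
  ... | u , refl = next u , inducedCycle⇒closedWalk {G = G} C u
  closedNbhd-adjacent (g , _ , g-enum , _) (inj₂ (a , a∈A , xa)) with Equivalence.to (g-enum a) a∈A
  ... | u , refl = u , xa

  smallOddCycle-nearPerfect : ∀ {m} → (suc m ≡ 3 ⊎ suc m ≡ 5 ⊎ suc m ≡ 7) →
    (g : Fin (suc m) → Fin n) → IsClosedWalk G g → ∀ u → NearPerfectMatching G g u
  smallOddCycle-nearPerfect (inj₁ refl)        = oddClosedWalk-nearPerfect {k = 1}
  smallOddCycle-nearPerfect (inj₂ (inj₁ refl)) = oddClosedWalk-nearPerfect {k = 2}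
  smallOddCycle-nearPerfect (inj₂ (inj₂ refl)) = oddClosedWalk-nearPerfect {k = 3}

  smallOddCycle-𝟙+e : ∀ {s} {P : Fin (suc s) → Subset n} → IsPartition P →
    (∀ k → IsEdgePart G (P (inject₁ k))) → IsSmallOddCycle G (P (fromℕ s)) →
    ∀ {x} → InClosedNbhd G (P (fromℕ s)) x → ∀ {c} → 2 * c ≡ suc n → EdgeComb G (λ v → 1 + δ v x) c
  smallOddCycle-𝟙+e partition edges (_ , small , C@(g , g-inj , g-enum , _)) x∈N[C] 2c≡1+n
    with closedNbhd-adjacent C x∈N[C]
  ... | u , xgu
    with partition-𝟙+e partition edges g-inj g-enum
           (smallOddCycle-nearPerfect small g (inducedCycle⇒closedWalk {G = G} C) u) xgu
  ...   | _ , E = EdgeComb-cong (λ _ → refl) (𝟙+e-size E 2c≡1+n) E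

  apart-oddCycle-absurd : ∀ {c} → Normal G → ΩAt G c → ∀ {x} → EdgeComb G (λ v → 1 + δ v x) c →
    ∀ {k} {f : Fin (suc (k + k)) → Fin n} → Injective _≡_ _≡_ f → IsClosedWalk G f →
    (∀ t → f t ≢ x) → (∀ t → ¬ Adj G x (f t)) → ⊥
  apart-oddCycle-absurd {c} normal Ω {x} X {k} {f} f-inj walk x∉f x≁f =
    contradiction (ℕP.+-cancelˡ-≤ (suc (k + k)) 2 1 (subst (suc (k + k) + 2 ≤_) (2*1+k k) size-bound))
                  λ { (s≤s ()) }
    where
    open +-*-Solver
    A : Fin n → ℕ
    A v = occ f v + δ v x
    S : ℕComb G (λ v → 1 + (A v + A v)) (c + (suc k + suc k))
    S = record
      { vertexCoeff  = λ v → δ v x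
      ; tCoeff       = 0
      ; edges        = EdgeComb-+ X (closedWalk-comb f walk)
      ; degree-split = λ v → degree-eq (δ v x) (occ f v)
      ; size-split   = trans (cong (λ y → y + (c + suc (k + k)) + 0) (sum-δ x)) (size-eq c k)
      }
      where
      degree-eq : ∀ d r → d + ((1 + d) + (r + r)) ≡ 1 + ((r + d) + (r + d))
      degree-eq = solve 2 (λ d r → d :+ ((con 1 :+ d) :+ (r :+ r)) := con 1 :+ ((r :+ d) :+ (r :+ d))) refl
      size-eq : ∀ c k → 1 + (c + suc (k + k)) + 0 ≡ c + (suc k + suc k)
      size-eq = solve 2 (λ c k → con 1 :+ (c :+ (con 1 :+ (k :+ k))) :+ con 0
                              := c :+ ((con 1 :+ k) :+ (con 1 :+ k))) refl
    size-bound : suc (k + k) + 2 ≤ 2 * suc k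
    size-bound = ℕComb-apart-size {G = G} f-inj x∉f x≁f (ℕComb-halve {G = G} normal Ω {a = A} {b = suc k} S)
    2*1+k : ∀ k → 2 * suc k ≡ suc (k + k) + 1
    2*1+k = solve 1 (λ k → con 2 :* (con 1 :+ k) := (con 1 :+ (k :+ k)) :+ con 1) refl

proposition3p17 : ∀ (n : ℕ) (G : Graph n) → Connected G → HasEdge G →
    Normal G → OmegaPrincipal G →
    ∀ (s : ℕ) (P : Fin (suc s) → Subset n) →
    IsCeilTauReduction G s P → IsSmallOddCycle G (P (fromℕ s)) →
    IsStrong G s P
proposition3p17 n G _ _ normal (c , 2c≡1+n , Ω) s P ((partition , _) , edges , _) C = inj₂ (C , meets)
  where
  meets : ∀ x → InClosedNbhd G (P (fromℕ s)) x → ∀ k f → IsOddCycle G k f →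
    ∃[ z ] Adj G x z × ((∃[ i ] f i ≡ x) ⊎ (∃[ i ] f i ≡ z))
  meets x x∈N[C] k f f-odd@(_ , f-inj , _)
    with FinP.any? (λ t → f t ≟ x) | FinP.any? (λ t → T? (adj G x (f t)))
  ... | yes (t , refl) | _              = f (next t) , oddCycle⇒closedWalk {G = G} f-odd t , inj₁ (t , refl)
  ... | no _           | yes (t , x~ft) = f t , x~ft , inj₂ (t , refl)
  ... | no x∉f         | no x≁f         = ⊥-elim (apart-oddCycle-absurd {G = G} {c} normal Ω
          (smallOddCycle-𝟙+e partition edges C x∈N[C] 2c≡1+n) {k} {f} f-inj (oddCycle⇒closedWalk {G = G} f-odd)
          (λ t ft≡x → x∉f (t , ft≡x)) (λ t x~ft → x≁f (t , x~ft)))
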